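{- Up to $\mathbf{S5[Con]}$-provable equivalence, there are exactly $4096$ formulas of $\mathcal{L}_\Box$ whose only variable is $x$.
   Context: $\mathcal{L}_\Box$ is the modal language with a countably infinite set of variables, two one-place predicate symbols $T,F$, and formulas $\varphi::=T(x)\mid F(x)\mid\neg\varphi\mid(\varphi\wedge\varphi)\mid\Box\varphi$; $\vee,\to,\leftrightarrow,\lozenge$ are abbreviations. $\mathbf{S5}$ in this signature is the least set of $\mathcal{L}_\Box$ formulas containing all substitution instances of classical propositional tautologies and all instances of $\Box(A\to B)\to(\Box A\to\Box B)$, $\Box A\to A$, $\lozenge A\to\Box\lozenge A$, closed under modus ponens and necessitation. $\mathbf{S5[Con]}$ additionally has the axioms $\neg(T(y)\wedge F(y))$ for every variable $y$, closed under the same rules. Two formulas are $\mathbf{S5[Con]}$-equivalent if $\mathbf{S5[Con]}\vdash\varphi\leftrightarrow\psi$. -}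

module Defs where

open import Data.Nat using (ℕ)
open import Data.Bool using (Bool; true; false; not; _∧_)
open import Data.Fin using (Fin)
open import Data.Product using (Σ; _×_)
open import Data.Unit using (⊤)
open import Relation.Binary.PropositionalEquality using (_≡_)
open import Relation.Nullary using (¬_)

data Form : Set where
  T   : ℕ → Form
  F   : ℕ → Form
  ~_  : Form → Form
  _∧'_ : Form → Form → Form
  □_  : Form → Form

infixr 6 _∧'_
infix 7 ~_ □_

_∨'_ : Form → Form → Form
φ ∨' ψ = ~ ((~ φ) ∧' (~ ψ))

_⇒_ : Form → Form → Form
φ ⇒ ψ = ~ (φ ∧' (~ ψ))

_⇔_ : Form → Form → Form
φ ⇔ ψ = (φ ⇒ ψ) ∧' (ψ ⇒ φ)

◇_ : Form → Form
◇ φ = ~ (□ (~ φ))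

infixr 5 _∨'_
infixr 4 _⇒_
infix 3 _⇔_

data PForm : Set where
  atom : ℕ → PForm
  pneg : PForm → PForm
  pand : PForm → PForm → PForm

eval : (ℕ → Bool) → PForm → Bool
eval v (atom n)   = v n
eval v (pneg p)   = not (eval v p)
eval v (pand p q) = eval v p ∧ eval v q

Tautology : PForm → Set
Tautology p = (v : ℕ → Bool) → eval v p ≡ true

psubst : (ℕ → Form) → PForm → Form
psubst σ (atom n)   = σ n
psubst σ (pneg p)   = ~ psubst σ p
psubst σ (pand p q) = psubst σ p ∧' psubst σ q

data S5Con⊢_ : Form → Set where
  taut : (p : PForm) → Tautology p → (σ : ℕ → Form) → S5Con⊢ psubst σ p
  axK  : (A B : Form) → S5Con⊢ (□ (A ⇒ B) ⇒ (□ A ⇒ □ B))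
  axT  : (A : Form) → S5Con⊢ (□ A ⇒ A)
  ax5  : (A : Form) → S5Con⊢ (◇ A ⇒ □ (◇ A))
  con  : (y : ℕ) → S5Con⊢ (~ (T y ∧' F y))
  mp   : {A B : Form} → S5Con⊢ (A ⇒ B) → S5Con⊢ A → S5Con⊢ B
  nec  : {A : Form} → S5Con⊢ A → S5Con⊢ (□ A)

infix 2 S5Con⊢_

_≈S5Con_ : Form → Form → Set
φ ≈S5Con ψ = S5Con⊢ (φ ⇔ ψ)

OnlyVar : ℕ → Form → Set
OnlyVar x (T y)    = y ≡ x
OnlyVar x (F y)    = y ≡ x
OnlyVar x (~ φ)    = OnlyVar x φ
OnlyVar x (φ ∧' ψ) = OnlyVar x φ × OnlyVar x ψ
OnlyVar x (□ φ)    = OnlyVar x φ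

ExactlyClasses : ℕ → ℕ → Set
ExactlyClasses x n =
  Σ (Fin n → Form) λ f →
    ((i : Fin n) → OnlyVar x (f i)) ×
    ((i j : Fin n) → f i ≈S5Con f j → i ≡ j) ×
    ((φ : Form) → OnlyVar x φ → Σ (Fin n) λ i → φ ≈S5Con f i)

{-# OPTIONS --safe #-}
module Submission where

-- For formulas in the single variable x, a world is determined by which of T x, F x holds
-- (Con excludes both), and an S5 model by which of these three kinds of worlds it contains.
-- So there are twelve points (S , s) with s ∈ S, and each has a characteristic formula
-- δ = C s ∧ M S: C s describes the current world and M S which kinds are possible. M S is
-- provably necessary (axiom 5 and its dual), which makes the □ case of an induction on φ go
-- through: δ proves φ or ¬ φ according to the truth value of φ at (S , s). As the twelve δ
-- provably exhaust all cases, φ is equivalent to the disjunction of the δ of the points where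
-- φ holds, while soundness for these finite models separates the disjunctions of distinct sets
-- of points: the classes are the 2 ^ 12 subsets of points.

open import Defs
open import Data.Bool using (Bool; true; false; not; _∧_; _∨_; if_then_else_) renaming (T to IsTrue)
open import Data.Bool.Properties as Bool using (∧-inverseʳ; not-involutive; ∧-conicalˡ; ∧-conicalʳ; T-≡)
open import Data.Empty using (⊥-elim)
open import Data.Product using (Σ; _×_; _,_)
open import Data.List using (List; []; _∷_)
open import Data.List.NonEmpty using (List⁺; _∷_)
open import Data.List.Relation.Unary.All using (All; []; _∷_)
open import Data.Nat using (ℕ; zero; suc; _^_; _≤_; _<_; _⊔_; z≤n; _≟_)
open import Data.Nat.Properties using (n<1+n; ≤∧≢⇒<; <⇒≱; <-≤-trans; m≤m⊔n; m≤n⊔m)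
open import Function using (Equivalence; Inverse; _∘_)
open import Data.Fin as Fin using (Fin; zero; suc; combine; finToFun; funToFin)
open import Data.Fin.Properties using (all?; 2↔Bool; funToFin-finToFin; finToFun-funToFin)
open import Data.Vec using (lookup; []; _∷_)
open import Relation.Binary.PropositionalEquality using (_≡_; refl; sym; trans; cong; cong₂; subst; ≢-sym; module ≡-Reasoning)
open import Relation.Nullary using (yes; no; does)
open import Relation.Nullary.Decidable using (from-yes)

infixr 6 _∧ₚ_
infixr 5 _∨ₚ_
infixr 4 _⇒ₚ_
infix 7 ¬ₚ_

¬ₚ_ : PForm → PForm
¬ₚ_ = pneg

_∧ₚ_ _∨ₚ_ _⇒ₚ_ : PForm → PForm → PForm
_∧ₚ_ = pand
p ∨ₚ q = ¬ₚ (¬ₚ p ∧ₚ ¬ₚ q)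
p ⇒ₚ q = ¬ₚ (p ∧ₚ ¬ₚ q)

p₀ p₁ p₂ p₃ p₄ : PForm
p₀ = atom 0
p₁ = atom 1
p₂ = atom 2
p₃ = atom 3
p₄ = atom 4

atomBound : PForm → ℕ
atomBound (atom n)   = suc n
atomBound (pneg p)   = atomBound p
atomBound (pand p q) = atomBound p ⊔ atomBound q

eval-cong : ∀ p {v w : ℕ → Bool} → (∀ n → n < atomBound p → v n ≡ w n) → eval v p ≡ eval w p
eval-cong (atom n)   agree = agree n (n<1+n n)
eval-cong (pneg p)   agree = cong not (eval-cong p agree)
eval-cong (pand p q) agree = cong₂ _∧_
  (eval-cong p λ n n<p → agree n (<-≤-trans n<p (m≤m⊔n _ _)))
  (eval-cong q λ n n<q → agree n (<-≤-trans n<q (m≤n⊔m _ _)))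

_[_≔_] : (ℕ → Bool) → ℕ → Bool → ℕ → Bool
(w [ k ≔ b ]) n with n ≟ k
... | yes _ = b
... | no  _ = w n

validBelow : ℕ → (ℕ → Bool) → PForm → Bool
validBelow zero    w p = eval w p
validBelow (suc k) w p = validBelow k (w [ k ≔ true ]) p ∧ validBelow k (w [ k ≔ false ]) p

validBelow-branch : ∀ k w p b → validBelow (suc k) w p ≡ true → validBelow k (w [ k ≔ b ]) p ≡ true
validBelow-branch k w p true  = ∧-conicalˡ _ _
validBelow-branch k w p false = ∧-conicalʳ _ _

agree-update : ∀ {v w : ℕ → Bool} {m} k → (∀ n → suc k ≤ n → n < m → v n ≡ w n) →
               ∀ n → k ≤ n → n < m → v n ≡ (w [ k ≔ v k ]) n
agree-update k agree n k≤n n<m with n ≟ k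
... | yes refl = refl
... | no  n≢k  = agree n (≤∧≢⇒< k≤n (≢-sym n≢k)) n<m

validBelow-sound : ∀ k w p → validBelow k w p ≡ true →
                  ∀ v → (∀ n → k ≤ n → n < atomBound p → v n ≡ w n) → eval v p ≡ true
validBelow-sound zero    w p valid v agree = trans (eval-cong p λ n → agree n z≤n) valid
validBelow-sound (suc k) w p valid v agree =
  validBelow-sound k (w [ k ≔ v k ]) p (validBelow-branch k w p (v k) valid) v (agree-update k agree)

isTautology : PForm → Bool
isTautology p = validBelow (atomBound p) (λ _ → false) p

isTautology-sound : ∀ p → IsTrue (isTautology p) → Tautology p
isTautology-sound p check v = validBelow-sound (atomBound p) _ p (Equivalence.to T-≡ check) v
  λ n bound≤n n<bound → ⊥-elim (<⇒≱ n<bound bound≤n)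

eval-∨ₚ : ∀ v p q → eval v (p ∨ₚ q) ≡ eval v p ∨ eval v q
eval-∨ₚ v p q with eval v p
... | true  = refl
... | false = not-involutive _

⊥ₚ : PForm
⊥ₚ = p₀ ∧ₚ ¬ₚ p₀

⋁ₚ : ∀ {n} → (Fin n → Bool) → (Fin n → PForm) → PForm
⋁ₚ {zero}  t P = ⊥ₚ
⋁ₚ {suc n} t P = if t zero then P zero ∨ₚ ⋁ₚ (t ∘ suc) (P ∘ suc) else ⋁ₚ (t ∘ suc) (P ∘ suc)

eval-⋁ₚ-none : ∀ {n} v (t : Fin n → Bool) P → (∀ j → eval v (P j) ≡ false) → eval v (⋁ₚ t P) ≡ false
eval-⋁ₚ-none {zero}  v t P none = ∧-inverseʳ (v 0)
eval-⋁ₚ-none {suc n} v t P none with t zero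
... | true  = trans (eval-∨ₚ v (P zero) (⋁ₚ (t ∘ suc) (P ∘ suc)))
                    (cong₂ _∨_ (none zero) (eval-⋁ₚ-none v (t ∘ suc) (P ∘ suc) (none ∘ suc)))
... | false = eval-⋁ₚ-none v (t ∘ suc) (P ∘ suc) (none ∘ suc)

eval-⋁ₚ-unique : ∀ {n} v (t : Fin n → Bool) P k → (∀ j → eval v (P j) ≡ does (j Fin.≟ k)) →
                 eval v (⋁ₚ t P) ≡ t k
eval-⋁ₚ-unique {suc n} v t P zero only with t zero
... | true  = trans (eval-∨ₚ v (P zero) (⋁ₚ (t ∘ suc) (P ∘ suc)))
                    (cong (_∨ eval v (⋁ₚ (t ∘ suc) (P ∘ suc))) (only zero))
... | false = eval-⋁ₚ-none v (t ∘ suc) (P ∘ suc) (only ∘ suc)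
eval-⋁ₚ-unique {suc n} v t P (suc k) only with t zero
... | true  = trans (eval-∨ₚ v (P zero) (⋁ₚ (t ∘ suc) (P ∘ suc)))
                    (trans (cong (_∨ eval v (⋁ₚ (t ∘ suc) (P ∘ suc))) (only zero))
                           (eval-⋁ₚ-unique v (t ∘ suc) (P ∘ suc) k (λ j → only (suc j))))
... | false = eval-⋁ₚ-unique v (t ∘ suc) (P ∘ suc) k (λ j → only (suc j))

-- Atoms past the end of the list denote its last formula.
⟪_⟫ : List⁺ Form → ℕ → Form
⟪ A ∷ _      ⟫ zero    = A
⟪ A ∷ []     ⟫ (suc n) = A
⟪ _ ∷ B ∷ Bs ⟫ (suc n) = ⟪ B ∷ Bs ⟫ n

OnlyVar-psubst : ∀ {x σ} → (∀ n → OnlyVar x (σ n)) → ∀ p → OnlyVar x (psubst σ p)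
OnlyVar-psubst onlyσ (atom n)   = onlyσ n
OnlyVar-psubst onlyσ (pneg p)   = OnlyVar-psubst onlyσ p
OnlyVar-psubst onlyσ (pand p q) = OnlyVar-psubst onlyσ p , OnlyVar-psubst onlyσ q

infix 2 ⊢_
⊢_ : Form → Set
⊢_ = S5Con⊢_

chain : List PForm → PForm → PForm
chain []       q = q
chain (p ∷ ps) q = p ⇒ₚ chain ps q

tautologically : ∀ σ ps q → {IsTrue (isTautology (chain ps q))} →
                 All (λ p → ⊢ psubst ⟪ σ ⟫ p) ps → ⊢ psubst ⟪ σ ⟫ q
tautologically σ ps q {check} = discharge ps (taut (chain ps q) (isTautology-sound (chain ps q) check) ⟪ σ ⟫)
  where
  discharge : ∀ ps → ⊢ psubst ⟪ σ ⟫ (chain ps q) → All (λ p → ⊢ psubst ⟪ σ ⟫ p) ps → ⊢ psubst ⟪ σ ⟫ q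
  discharge []       ⊢q  []         = ⊢q
  discharge (p ∷ ps) ⊢p⇒ (⊢p ∷ ⊢ps) = discharge ps (mp ⊢p⇒ ⊢p) ⊢ps

variable
  A B D φ : Form

⇒-trans : ⊢ A ⇒ B → ⊢ B ⇒ D → ⊢ A ⇒ D
⇒-trans {A} {B} {D} h₁ h₂ =
  tautologically (A ∷ B ∷ D ∷ []) ((p₀ ⇒ₚ p₁) ∷ (p₁ ⇒ₚ p₂) ∷ []) (p₀ ⇒ₚ p₂) (h₁ ∷ h₂ ∷ [])

∧-elimˡ : ⊢ A ∧' B ⇒ A
∧-elimˡ {A} {B} = tautologically (A ∷ B ∷ []) [] (p₀ ∧ₚ p₁ ⇒ₚ p₀) []

∧-elimʳ : ⊢ A ∧' B ⇒ B
∧-elimʳ {A} {B} = tautologically (A ∷ B ∷ []) [] (p₀ ∧ₚ p₁ ⇒ₚ p₁) []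

∧-intro : ⊢ D ⇒ A → ⊢ D ⇒ B → ⊢ D ⇒ A ∧' B
∧-intro {D} {A} {B} h₁ h₂ =
  tautologically (D ∷ A ∷ B ∷ []) ((p₀ ⇒ₚ p₁) ∷ (p₀ ⇒ₚ p₂) ∷ []) (p₀ ⇒ₚ p₁ ∧ₚ p₂) (h₁ ∷ h₂ ∷ [])

∧-comm : ⊢ A ∧' B ⇒ B ∧' A
∧-comm = ∧-intro ∧-elimʳ ∧-elimˡ

contraposition : ⊢ A ⇒ B → ⊢ ~ B ⇒ ~ A
contraposition {A} {B} h = tautologically (A ∷ B ∷ []) ((p₀ ⇒ₚ p₁) ∷ []) (¬ₚ p₁ ⇒ₚ ¬ₚ p₀) (h ∷ [])

¬¬-intro : ⊢ A ⇒ ~ ~ A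
¬¬-intro {A} = tautologically (A ∷ []) [] (p₀ ⇒ₚ ¬ₚ ¬ₚ p₀) []

¬¬-elim : ⊢ ~ ~ A ⇒ A
¬¬-elim {A} = tautologically (A ∷ []) [] (¬ₚ ¬ₚ p₀ ⇒ₚ p₀) []

□-mono : ⊢ A ⇒ B → ⊢ □ A ⇒ □ B
□-mono h = mp (axK _ _) (nec h)

◇-mono : ⊢ A ⇒ B → ⊢ ◇ A ⇒ ◇ B
◇-mono h = contraposition (□-mono (contraposition h))

◇-intro : ⊢ A ⇒ ◇ A
◇-intro {A} = tautologically (A ∷ □ (~ A) ∷ []) ((p₁ ⇒ₚ ¬ₚ p₀) ∷ []) (p₀ ⇒ₚ ¬ₚ p₁) (axT (~ A) ∷ [])

□-∧ : ⊢ □ A ∧' □ B ⇒ □ (A ∧' B)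
□-∧ {A} {B} = tautologically (□ A ∷ □ (B ⇒ A ∧' B) ∷ □ B ∷ □ (A ∧' B) ∷ [])
  ((p₀ ⇒ₚ p₁) ∷ (p₁ ⇒ₚ p₂ ⇒ₚ p₃) ∷ []) (p₀ ∧ₚ p₂ ⇒ₚ p₃)
  (□-mono (tautologically (A ∷ B ∷ []) [] (p₀ ⇒ₚ p₁ ⇒ₚ p₀ ∧ₚ p₁) []) ∷ axK B (A ∧' B) ∷ [])

□◇-∧ : ⊢ □ A ∧' ◇ B ⇒ ◇ (A ∧' B)
□◇-∧ {A} {B} = tautologically (□ A ∷ □ (~ (A ∧' B) ⇒ ~ B) ∷ □ (~ (A ∧' B)) ∷ □ (~ B) ∷ [])
  ((p₀ ⇒ₚ p₁) ∷ (p₁ ⇒ₚ p₂ ⇒ₚ p₃) ∷ []) (p₀ ∧ₚ ¬ₚ p₃ ⇒ₚ ¬ₚ p₂)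
  (□-mono (tautologically (A ∷ B ∷ []) [] (p₀ ⇒ₚ ¬ₚ (p₀ ∧ₚ p₁) ⇒ₚ ¬ₚ p₁) []) ∷ axK (~ (A ∧' B)) (~ B) ∷ [])

◇¬⇒¬□ : ⊢ ◇ (~ A) ⇒ ~ □ A
◇¬⇒¬□ = contraposition (□-mono ¬¬-intro)

¬□⇒□¬□ : ⊢ ~ □ A ⇒ □ (~ □ A)
¬□⇒□¬□ {A} = ⇒-trans (contraposition (□-mono ¬¬-elim)) (⇒-trans (ax5 (~ A)) (□-mono ◇¬⇒¬□))

◇□⇒□ : ⊢ ◇ (□ A) ⇒ □ A
◇□⇒□ {A} = tautologically (□ A ∷ □ (~ □ A) ∷ []) ((¬ₚ p₀ ⇒ₚ p₁) ∷ []) (¬ₚ p₁ ⇒ₚ p₀) (¬□⇒□¬□ ∷ [])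

□⇒□□ : ⊢ □ A ⇒ □ (□ A)
□⇒□□ = ⇒-trans ◇-intro (⇒-trans (ax5 _) (□-mono ◇□⇒□))

¬◇⇒□¬◇ : ⊢ ~ ◇ A ⇒ □ (~ ◇ A)
¬◇⇒□¬◇ = ⇒-trans ¬¬-elim (⇒-trans □⇒□□ (□-mono ¬¬-intro))

∧-boxed : ⊢ A ⇒ □ A → ⊢ B ⇒ □ B → ⊢ A ∧' B ⇒ □ (A ∧' B)
∧-boxed h₁ h₂ = ⇒-trans (∧-intro (⇒-trans ∧-elimˡ h₁) (⇒-trans ∧-elimʳ h₂)) □-∧

⋁-elim : ∀ {n} σ (t : Fin n → Bool) P → (∀ k → ⊢ psubst σ (P k) ⇒ A) → ⊢ psubst σ (⋁ₚ t P) ⇒ A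
⋁-elim {A} {zero}  σ t P cases = tautologically (σ 0 ∷ A ∷ []) [] (⊥ₚ ⇒ₚ p₁) []
⋁-elim {A} {suc n} σ t P cases with t zero
... | true  = tautologically (psubst σ (P zero) ∷ psubst σ (⋁ₚ (t ∘ suc) (P ∘ suc)) ∷ A ∷ [])
                ((p₀ ⇒ₚ p₂) ∷ (p₁ ⇒ₚ p₂) ∷ []) (p₀ ∨ₚ p₁ ⇒ₚ p₂)
                (cases zero ∷ ⋁-elim σ (t ∘ suc) (P ∘ suc) (cases ∘ suc) ∷ [])
... | false = ⋁-elim σ (t ∘ suc) (P ∘ suc) (cases ∘ suc)

signed : Bool → Form → Form
signed true  φ = φ
signed false φ = ~ φ

signedₚ : Bool → PForm → PForm
signedₚ true  p = p
signedₚ false p = ¬ₚ p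

psubst-signed : ∀ σ b p → psubst σ (signedₚ b p) ≡ signed b (psubst σ p)
psubst-signed σ true  p = refl
psubst-signed σ false p = refl

signed-~ : ∀ b → ⊢ D ⇒ signed b A → ⊢ D ⇒ signed (not b) (~ A)
signed-~ true  h = ⇒-trans h ¬¬-intro
signed-~ false h = h

signed-∧ : ∀ b c → ⊢ D ⇒ signed b A → ⊢ D ⇒ signed c B → ⊢ D ⇒ signed (b ∧ c) (A ∧' B)
signed-∧ true  true  h₁ h₂ = ∧-intro h₁ h₂
signed-∧ true  false h₁ h₂ = ⇒-trans h₂ (contraposition ∧-elimʳ)
signed-∧ false c     h₁ h₂ = ⇒-trans h₁ (contraposition ∧-elimˡ)

signed-⇔ : ∀ b → ⊢ D ⇒ signed b A → ⊢ D ⇒ signed b B → ⊢ D ⇒ (A ⇔ B)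
signed-⇔ {D} {A} {B} true h₁ h₂ = tautologically (D ∷ A ∷ B ∷ [])
  ((p₀ ⇒ₚ p₁) ∷ (p₀ ⇒ₚ p₂) ∷ []) (p₀ ⇒ₚ (p₁ ⇒ₚ p₂) ∧ₚ (p₂ ⇒ₚ p₁)) (h₁ ∷ h₂ ∷ [])
signed-⇔ {D} {A} {B} false h₁ h₂ = tautologically (D ∷ A ∷ B ∷ [])
  ((p₀ ⇒ₚ ¬ₚ p₁) ∷ (p₀ ⇒ₚ ¬ₚ p₂) ∷ []) (p₀ ⇒ₚ (p₁ ⇒ₚ p₂) ∧ₚ (p₂ ⇒ₚ p₁)) (h₁ ∷ h₂ ∷ [])

◇-signed-boxed : ∀ b → ⊢ signed b (◇ A) ⇒ □ signed b (◇ A)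
◇-signed-boxed true  = ax5 _
◇-signed-boxed false = ¬◇⇒□¬◇

data World : Set where
  wT wF wN : World

Model : Set
Model = World → Bool

Point : Set
Point = Model × World

inside : Point → Bool
inside (S , s) = S s

T-at F-at : World → Bool
T-at wT = true
T-at _  = false
F-at wF = true
F-at _  = false

_⇒ᵇ_ : Bool → Bool → Bool
a ⇒ᵇ b = not (a ∧ not b)

every : Model → (World → Bool) → Bool
every S r = (S wT ⇒ᵇ r wT) ∧ (S wF ⇒ᵇ r wF) ∧ (S wN ⇒ᵇ r wN)

sem : Model → World → Form → Bool
sem S s (T _)    = T-at s
sem S s (F _)    = F-at s
sem S s (~ φ)    = not (sem S s φ)
sem S s (φ ∧' ψ) = sem S s φ ∧ sem S s ψ
sem S s (□ φ)    = every S λ u → sem S u φ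

⟦_⟧ : Form → Point → Bool
⟦ φ ⟧ (S , s) = sem S s φ

⇒ᵇ-intro : ∀ a b → (a ≡ true → b ≡ true) → a ⇒ᵇ b ≡ true
⇒ᵇ-intro false b h = refl
⇒ᵇ-intro true  b h rewrite h refl = refl

⇒ᵇ-elim : ∀ a b → a ⇒ᵇ b ≡ true → a ≡ true → b ≡ true
⇒ᵇ-elim true true _ _ = refl

⇒ᵇ-false : ∀ {a b} → a ⇒ᵇ b ≡ false → a ≡ true × b ≡ false
⇒ᵇ-false {true} {false} _ = refl , refl

every-intro : ∀ S r → (∀ u → S u ≡ true → r u ≡ true) → every S r ≡ true
every-intro S r h = cong₂ _∧_ (⇒ᵇ-intro _ _ (h wT)) (cong₂ _∧_ (⇒ᵇ-intro _ _ (h wF)) (⇒ᵇ-intro _ _ (h wN)))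

every-elim : ∀ S r → every S r ≡ true → ∀ u → S u ≡ true → r u ≡ true
every-elim S r h wT = ⇒ᵇ-elim _ _ (∧-conicalˡ (S wT ⇒ᵇ r wT) _ h)
every-elim S r h wF = ⇒ᵇ-elim _ _ (∧-conicalˡ (S wF ⇒ᵇ r wF) _ (∧-conicalʳ (S wT ⇒ᵇ r wT) _ h))
every-elim S r h wN = ⇒ᵇ-elim _ _ (∧-conicalʳ (S wF ⇒ᵇ r wF) _ (∧-conicalʳ (S wT ⇒ᵇ r wT) _ h))

every-counterexample : ∀ S r → every S r ≡ false → Σ World λ u → S u ≡ true × r u ≡ false
every-counterexample S r h with S wT ⇒ᵇ r wT in hT | S wF ⇒ᵇ r wF in hF | S wN ⇒ᵇ r wN in hN
... | false | _     | _     = wT , ⇒ᵇ-false hT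
... | true  | false | _     = wF , ⇒ᵇ-false hF
... | true  | true  | false = wN , ⇒ᵇ-false hN
every-counterexample S r () | true | true | true

⟦⟧-psubst : ∀ σ p q → ⟦ psubst σ p ⟧ q ≡ eval (λ n → ⟦ σ n ⟧ q) p
⟦⟧-psubst σ (atom n)   q       = refl
⟦⟧-psubst σ (pneg p)   (S , s) = cong not (⟦⟧-psubst σ p (S , s))
⟦⟧-psubst σ (pand p q) (S , s) = cong₂ _∧_ (⟦⟧-psubst σ p (S , s)) (⟦⟧-psubst σ q (S , s))

sound : ⊢ A → ∀ p → inside p ≡ true → ⟦ A ⟧ p ≡ true
sound (taut p tautology σ) q _ = trans (⟦⟧-psubst σ p q) (tautology _)
sound (axK A B) (S , s) _ =
  ⇒ᵇ-intro _ _ λ □A⇒B → ⇒ᵇ-intro _ _ λ □A → every-intro S (λ u → sem S u B) λ u Su →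
    ⇒ᵇ-elim (sem S u A) _ (every-elim S (λ u → sem S u (A ⇒ B)) □A⇒B u Su)
                          (every-elim S (λ u → sem S u A) □A u Su)
sound (axT A) (S , s) Ss = ⇒ᵇ-intro _ _ λ □A → every-elim S (λ u → sem S u A) □A s Ss
sound (ax5 A) (S , s) _  = ⇒ᵇ-intro _ _ λ ◇A → every-intro S (λ u → sem S u (◇ A)) λ _ _ → ◇A
sound (con y) (S , wT) _ = refl
sound (con y) (S , wF) _ = refl
sound (con y) (S , wN) _ = refl
sound (mp {A} ⊢A⇒B ⊢A) (S , s) Ss = ⇒ᵇ-elim (sem S s A) _ (sound ⊢A⇒B (S , s) Ss) (sound ⊢A (S , s) Ss)
sound (nec {A} ⊢A) (S , s) _ = every-intro S (λ u → sem S u A) λ u Su → sound ⊢A (S , u) Su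

⟦⇔⟧-true : ∀ A B p → ⟦ A ⇔ B ⟧ p ≡ true → ⟦ A ⟧ p ≡ ⟦ B ⟧ p
⟦⇔⟧-true A B (S , s) h with sem S s A | sem S s B
... | true  | true  = refl
... | false | false = refl
⟦⇔⟧-true A B (S , s) () | true  | false
⟦⇔⟧-true A B (S , s) () | false | true

cluster : Bool → Bool → Bool → Model
cluster a b c wT = a
cluster a b c wF = b
cluster a b c wN = c

point : Fin 12 → Point
point = lookup
  ( (cluster true  false false , wT) ∷ (cluster false true  false , wF) ∷ (cluster false false true , wN)
  ∷ (cluster true  true  false , wT) ∷ (cluster true  true  false , wF)
  ∷ (cluster true  false true  , wT) ∷ (cluster true  false true  , wN)
  ∷ (cluster false true  true  , wF) ∷ (cluster false true  true  , wN)
  ∷ (cluster true  true  true  , wT) ∷ (cluster true  true  true  , wF) ∷ (cluster true true true , wN) ∷ [])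

point-inside : ∀ k → inside (point k) ≡ true
point-inside = from-yes (all? λ k → inside (point k) Bool.≟ true)

-- Propositional skeletons of C and δ below, over the atoms T x, F x, ◇ C wT, ◇ C wF, ◇ C wN of basic.
Cₚ : World → PForm
Cₚ wT = p₀
Cₚ wF = p₁
Cₚ wN = ¬ₚ p₀ ∧ₚ ¬ₚ p₁

δₚ : Point → PForm
δₚ (S , s) = Cₚ s ∧ₚ signedₚ (S wT) p₂ ∧ₚ signedₚ (S wF) p₃ ∧ₚ signedₚ (S wN) p₄

module OneVariable (x : ℕ) where

  C : World → Form
  C wT = T x
  C wF = F x
  C wN = ~ T x ∧' ~ F x

  M : Model → Form
  M S = signed (S wT) (◇ C wT) ∧' signed (S wF) (◇ C wF) ∧' signed (S wN) (◇ C wN)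

  δ : Point → Form
  δ (S , s) = C s ∧' M S

  basic : ℕ → Form
  basic = ⟪ T x ∷ F x ∷ ◇ C wT ∷ ◇ C wF ∷ ◇ C wN ∷ [] ⟫

  OnlyVar-basic : ∀ n → OnlyVar x (basic n)
  OnlyVar-basic 0 = refl
  OnlyVar-basic 1 = refl
  OnlyVar-basic 2 = refl
  OnlyVar-basic 3 = refl
  OnlyVar-basic 4 = refl , refl
  OnlyVar-basic (suc (suc (suc (suc (suc _))))) = refl , refl

  δ-template : ∀ p → psubst basic (δₚ p) ≡ δ p
  δ-template (S , s) = cong₂ _∧'_ (C-template s) (cong₂ _∧'_ (psubst-signed basic (S wT) p₂)
                         (cong₂ _∧'_ (psubst-signed basic (S wF) p₃) (psubst-signed basic (S wN) p₄)))
    where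
    C-template : ∀ s → psubst basic (Cₚ s) ≡ C s
    C-template wT = refl
    C-template wF = refl
    C-template wN = refl

  C-decides-T : ∀ s → ⊢ C s ⇒ signed (T-at s) (T x)
  C-decides-T wT = tautologically (T x ∷ []) [] (p₀ ⇒ₚ p₀) []
  C-decides-T wF = tautologically (T x ∷ F x ∷ []) (¬ₚ (p₀ ∧ₚ p₁) ∷ []) (p₁ ⇒ₚ ¬ₚ p₀) (con x ∷ [])
  C-decides-T wN = tautologically (T x ∷ F x ∷ []) [] (¬ₚ p₀ ∧ₚ ¬ₚ p₁ ⇒ₚ ¬ₚ p₀) []

  C-decides-F : ∀ s → ⊢ C s ⇒ signed (F-at s) (F x)
  C-decides-F wT = tautologically (T x ∷ F x ∷ []) (¬ₚ (p₀ ∧ₚ p₁) ∷ []) (p₀ ⇒ₚ ¬ₚ p₁) (con x ∷ [])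
  C-decides-F wF = tautologically (F x ∷ []) [] (p₀ ⇒ₚ p₀) []
  C-decides-F wN = tautologically (T x ∷ F x ∷ []) [] (¬ₚ p₀ ∧ₚ ¬ₚ p₁ ⇒ₚ ¬ₚ p₁) []

  M-◇ : ∀ S u {b} → S u ≡ b → ⊢ M S ⇒ signed b (◇ C u)
  M-◇ S wT refl = ∧-elimˡ
  M-◇ S wF refl = ⇒-trans ∧-elimʳ ∧-elimˡ
  M-◇ S wN refl = ⇒-trans ∧-elimʳ ∧-elimʳ

  M-boxed : ∀ S → ⊢ M S ⇒ □ M S
  M-boxed S = ∧-boxed (◇-signed-boxed (S wT)) (∧-boxed (◇-signed-boxed (S wF)) (◇-signed-boxed (S wN)))

  M⇒□ : ∀ S r → (∀ u → ⊢ C u ∧' M S ⇒ signed (r u) φ) → every S r ≡ true → ⊢ M S ⇒ □ φ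
  M⇒□ {φ} S r decides all = ⇒-trans (M-boxed S) (□-mono M⇒φ)
    where
    M⇒C⇒φ : ∀ u → ⊢ M S ⇒ (C u ⇒ φ)
    M⇒C⇒φ u with S u in Su
    ... | true  = tautologically (C u ∷ M S ∷ φ ∷ []) ((p₀ ∧ₚ p₁ ⇒ₚ p₂) ∷ []) (p₁ ⇒ₚ p₀ ⇒ₚ p₂)
                    (subst (λ b → ⊢ C u ∧' M S ⇒ signed b φ) (every-elim S r all u Su) (decides u) ∷ [])
    ... | false = tautologically (C u ∷ M S ∷ φ ∷ ◇ C u ∷ []) ((p₁ ⇒ₚ ¬ₚ p₃) ∷ (p₀ ⇒ₚ p₃) ∷ [])
                    (p₁ ⇒ₚ p₀ ⇒ₚ p₂) (M-◇ S u Su ∷ ◇-intro ∷ [])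
    M⇒φ : ⊢ M S ⇒ φ
    M⇒φ = tautologically (T x ∷ F x ∷ M S ∷ φ ∷ [])
      ((p₂ ⇒ₚ p₀ ⇒ₚ p₃) ∷ (p₂ ⇒ₚ p₁ ⇒ₚ p₃) ∷ (p₂ ⇒ₚ ¬ₚ p₀ ∧ₚ ¬ₚ p₁ ⇒ₚ p₃) ∷ []) (p₂ ⇒ₚ p₃)
      (M⇒C⇒φ wT ∷ M⇒C⇒φ wF ∷ M⇒C⇒φ wN ∷ [])

  M⇒¬□ : ∀ S u → S u ≡ true → ⊢ C u ∧' M S ⇒ ~ φ → ⊢ M S ⇒ ~ □ φ
  M⇒¬□ S u Su refutes = ⇒-trans (∧-intro (M-boxed S) (M-◇ S u Su))
    (⇒-trans □◇-∧ (⇒-trans (◇-mono (⇒-trans ∧-comm refutes)) ◇¬⇒¬□))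

  M-decides-□ : ∀ S r → (∀ u → ⊢ C u ∧' M S ⇒ signed (r u) φ) → ⊢ M S ⇒ signed (every S r) (□ φ)
  M-decides-□ {φ} S r decides with every S r in all
  ... | true  = M⇒□ S r decides all
  ... | false with u , Su , ru ← every-counterexample S r all =
    M⇒¬□ S u Su (subst (λ b → ⊢ C u ∧' M S ⇒ signed b φ) ru (decides u))

  δ-decides : ∀ φ → OnlyVar x φ → ∀ p → ⊢ δ p ⇒ signed (⟦ φ ⟧ p) φ
  δ-decides (T y)    refl      (S , s) = ⇒-trans ∧-elimˡ (C-decides-T s)
  δ-decides (F y)    refl      (S , s) = ⇒-trans ∧-elimˡ (C-decides-F s)
  δ-decides (~ φ)    only      p       = signed-~ (⟦ φ ⟧ p) (δ-decides φ only p)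
  δ-decides (φ ∧' ψ) (oφ , oψ) p       = signed-∧ (⟦ φ ⟧ p) (⟦ ψ ⟧ p) (δ-decides φ oφ p) (δ-decides ψ oψ p)
  δ-decides (□ φ)    only      (S , s) = ⇒-trans ∧-elimʳ (M-decides-□ S _ λ u → δ-decides φ only (S , u))

  -- The valuations of the five atoms that match no δₚ (point k) are exactly those in which the
  -- current kind of world is not possible; the premises exclude them.
  exhaustive : ⊢ psubst basic (⋁ₚ (λ _ → true) (δₚ ∘ point))
  exhaustive = tautologically (T x ∷ F x ∷ ◇ C wT ∷ ◇ C wF ∷ ◇ C wN ∷ [])
    ((p₀ ⇒ₚ p₂) ∷ (p₁ ⇒ₚ p₃) ∷ (Cₚ wN ⇒ₚ p₄) ∷ []) (⋁ₚ (λ _ → true) (δₚ ∘ point))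
    (◇-intro ∷ ◇-intro ∷ ◇-intro ∷ [])

  points-separated : ∀ j k → eval (λ n → ⟦ basic n ⟧ (point k)) (δₚ (point j)) ≡ does (j Fin.≟ k)
  points-separated = from-yes (all? λ j → all? λ k →
    eval (λ n → ⟦ basic n ⟧ (point k)) (δₚ (point j)) Bool.≟ does (j Fin.≟ k))

  canonical : (Fin 12 → Bool) → Form
  canonical t = psubst basic (⋁ₚ t (δₚ ∘ point))

  OnlyVar-canonical : ∀ t → OnlyVar x (canonical t)
  OnlyVar-canonical t = OnlyVar-psubst OnlyVar-basic (⋁ₚ t (δₚ ∘ point))

  ⟦canonical⟧ : ∀ t k → ⟦ canonical t ⟧ (point k) ≡ t k
  ⟦canonical⟧ t k = trans (⟦⟧-psubst basic (⋁ₚ t (δₚ ∘ point)) (point k))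
    (eval-⋁ₚ-unique _ t (δₚ ∘ point) k λ j → points-separated j k)

  ≈-canonical : ∀ φ → OnlyVar x φ → ∀ t → (∀ k → t k ≡ ⟦ φ ⟧ (point k)) → φ ≈S5Con canonical t
  ≈-canonical φ only t table = mp (⋁-elim basic (λ _ → true) (δₚ ∘ point) δ-decides-⇔) exhaustive
    where
    δ-decides-⇔ : ∀ k → ⊢ psubst basic (δₚ (point k)) ⇒ (φ ⇔ canonical t)
    δ-decides-⇔ k = subst (λ D → ⊢ D ⇒ (φ ⇔ canonical t)) (sym (δ-template (point k)))
      (signed-⇔ (⟦ φ ⟧ (point k)) (δ-decides φ only (point k))
        (subst (λ b → ⊢ δ (point k) ⇒ signed b (canonical t)) (trans (⟦canonical⟧ t k) (table k))
               (δ-decides (canonical t) (OnlyVar-canonical t) (point k))))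

  canonical-separates : ∀ t u → canonical t ≈S5Con canonical u → ∀ k → t k ≡ u k
  canonical-separates t u eq k = begin
    t k                        ≡⟨ ⟦canonical⟧ t k ⟨
    ⟦ canonical t ⟧ (point k)  ≡⟨ ⟦⇔⟧-true (canonical t) (canonical u) (point k)
                                                (sound eq (point k) (point-inside k)) ⟩
    ⟦ canonical u ⟧ (point k)  ≡⟨ ⟦canonical⟧ u k ⟩
    u k                        ∎
    where open ≡-Reasoning

funToFin-cong : ∀ {m n} {f g : Fin m → Fin n} → (∀ k → f k ≡ g k) → funToFin f ≡ funToFin g
funToFin-cong {zero}  f≗g = refl
funToFin-cong {suc m} f≗g = cong₂ combine (f≗g zero) (funToFin-cong (f≗g ∘ suc))

bits : ∀ {n} → Fin (2 ^ n) → Fin n → Bool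
bits {n} i = Inverse.to 2↔Bool ∘ finToFun {2} {n} i

bits-injective : ∀ {n} {i j : Fin (2 ^ n)} → (∀ k → bits i k ≡ bits j k) → i ≡ j
bits-injective {n} {i} {j} same = begin
  i                      ≡⟨ funToFin-finToFin {n} {2} i ⟨
  funToFin (digits i)    ≡⟨ funToFin-cong same-digit ⟩
  funToFin (digits j)    ≡⟨ funToFin-finToFin {n} {2} j ⟩
  j                      ∎
  where
  open ≡-Reasoning
  open Inverse 2↔Bool using (from; to; strictlyInverseʳ)
  digits : Fin (2 ^ n) → Fin n → Fin 2
  digits = finToFun
  same-digit : ∀ k → digits i k ≡ digits j k
  same-digit k = begin
    digits i k              ≡⟨ strictlyInverseʳ _ ⟨
    from (to (digits i k))  ≡⟨ cong from (same k) ⟩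
    from (to (digits j k))  ≡⟨ strictlyInverseʳ _ ⟩
    digits j k              ∎

bits-surjective : ∀ {n} (t : Fin n → Bool) → Σ (Fin (2 ^ n)) λ i → ∀ k → bits i k ≡ t k
bits-surjective t = funToFin (from ∘ t) , λ k →
  trans (cong to (finToFun-funToFin (from ∘ t) k)) (strictlyInverseˡ (t k))
  where open Inverse 2↔Bool using (from; to; strictlyInverseˡ)

mainTheorem5 : (x : ℕ) → ExactlyClasses x 4096
mainTheorem5 x = canonical ∘ bits , OnlyVar-canonical ∘ bits , distinct , complete
  where
  open OneVariable x
  distinct : ∀ i j → canonical (bits i) ≈S5Con canonical (bits j) → i ≡ j
  distinct i j eq = bits-injective (canonical-separates (bits i) (bits j) eq)
  complete : ∀ φ → OnlyVar x φ → Σ (Fin 4096) λ i → φ ≈S5Con canonical (bits i)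
  complete φ only = let i , bits-i = bits-surjective (λ k → ⟦ φ ⟧ (point k)) in
    i , ≈-canonical φ only (bits i) bits-i
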